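{- The functions $\mathrm{Sum}$ and $\mathrm{Prod}$ are not $(\mathcal{U},\mathcal{P})$-definable.
   Context: $\mathbb{N}=\{0,1,2,\ldots\}$, $2^{\mathbb{N}}$ is its power set. A set-function is a map $(2^{\mathbb{N}})^k\to 2^{\mathbb{N}}$ for some $k\ge 0$. For a collection $\mathcal{O}$ of set-functions, $\mathcal{O}$-circuits are terms built from variables ranging over $2^{\mathbb{N}}$, the constants $\emptyset$, $\mathbb{N}$, $\{n\}$ ($n\in\mathbb{N}$), the operations $\cup$, $\cap$, complement relative to $\mathbb{N}$, and the functions in $\mathcal{O}$; a set-function is $\mathcal{O}$-definable if some $\mathcal{O}$-circuit evaluates to it; "$(\mathcal{U},\mathcal{P})$-definable" means $(\mathcal{U}\cup\mathcal{P})$-definable. For $s\subseteq\mathbb{N}$, $s_{|m}=s\cap\{0,\ldots,m\}$, componentwise on tuples. A set-function $G$ of arity $n$ is continuous at $\vec s$ if for every $m$ there is $n'$ such that for all $\vec t$, $\vec t_{|n'}=\vec s_{|n'}$ implies $G(\vec t)_{|m}=G(\vec s)_{|m}$. $\mathcal{U}$ is the collection of all set-functions (all arities) continuous everywhere; $\mathcal{P}$ is the collection of all set-functions (all arities) whose values all lie in $\{\emptyset,\{0\}\}$. $\mathrm{Sum}(x)=\{\sum_{n\in x}n\}$ and $\mathrm{Prod}(x)=\{\prod_{n\in x}n\}$ if $x$ is finite (empty sum $0$, empty product $1$), and both equal $\mathbb{N}$ if $x$ is infinite. -}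

module Defs where

open import Data.Nat using (ℕ; zero; suc; _+_; _*_; _≤_; _<_; _≡ᵇ_)
open import Data.Bool using (Bool; true; false; _∧_; _∨_; not; if_then_else_)
open import Data.Fin using (Fin)
open import Data.Sum using (_⊎_)
open import Data.Product using (Σ; ∃; _×_)
open import Relation.Nullary using (¬_)
open import Relation.Binary.PropositionalEquality using (_≡_)

NSet : Set
NSet = ℕ → Bool

_≈_ : NSet → NSet → Set
s ≈ t = ∀ n → s n ≡ t n

∅ : NSet
∅ _ = false

full : NSet
full _ = true

⟦_⟧ : ℕ → NSet
⟦ m ⟧ n = n ≡ᵇ m

SetFun : ℕ → Set
SetFun k = (Fin k → NSet) → NSet

AgreeUpTo : ℕ → NSet → NSet → Set
AgreeUpTo m s t = ∀ i → i ≤ m → s i ≡ t i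

AgreeUpToVec : ∀ {k} → ℕ → (Fin k → NSet) → (Fin k → NSet) → Set
AgreeUpToVec m ss ts = ∀ j → AgreeUpTo m (ss j) (ts j)

ContinuousAt : ∀ {k} → SetFun k → (Fin k → NSet) → Set
ContinuousAt G ss =
  ∀ m → ∃ λ n' → ∀ ts → AgreeUpToVec n' ts ss → AgreeUpTo m (G ts) (G ss)

InU : ∀ {k} → SetFun k → Set
InU G = ∀ ss → ContinuousAt G ss

InP : ∀ {k} → SetFun k → Set
InP G = ∀ ss → (G ss ≈ ∅) ⊎ (G ss ≈ ⟦ 0 ⟧)

data Circuit (k : ℕ) : Set where
  var   : Fin k → Circuit k
  empty : Circuit k
  nat   : Circuit k
  sing  : ℕ → Circuit k
  union : Circuit k → Circuit k → Circuit k
  inter : Circuit k → Circuit k → Circuit k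
  compl : Circuit k → Circuit k
  op    : (j : ℕ) (G : SetFun j) → InU G ⊎ InP G → (Fin j → Circuit k) → Circuit k

eval : ∀ {k} → Circuit k → SetFun k
eval (var i) xs = xs i
eval empty xs = ∅
eval nat xs = full
eval (sing m) xs = ⟦ m ⟧
eval (union c d) xs n = eval c xs n ∨ eval d xs n
eval (inter c d) xs n = eval c xs n ∧ eval d xs n
eval (compl c) xs n = not (eval c xs n)
eval (op j G _ cs) xs = G (λ i → eval (cs i) xs)

BoundedBy : NSet → ℕ → Set
BoundedBy x m = ∀ n → m ≤ n → x n ≡ false

Finite : NSet → Set
Finite x = ∃ λ m → BoundedBy x m

sumBelow : NSet → ℕ → ℕ
sumBelow x zero = 0
sumBelow x (suc m) = sumBelow x m + (if x m then m else 0)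

prodBelow : NSet → ℕ → ℕ
prodBelow x zero = 1
prodBelow x (suc m) = prodBelow x m * (if x m then m else 1)

IsSum : NSet → NSet → Set
IsSum x y = (∀ m → BoundedBy x m → y ≈ ⟦ sumBelow x m ⟧)
          × (¬ Finite x → y ≈ full)

IsProd : NSet → NSet → Set
IsProd x y = (∀ m → BoundedBy x m → y ≈ ⟦ prodBelow x m ⟧)
           × (¬ Finite x → y ≈ full)

-- a unary set-function (given as its graph R) is (𝒰,𝒫)-definable
UPDefinable₁ : (NSet → NSet → Set) → Set
UPDefinable₁ R = Σ (Circuit 1) λ C → ∀ x → R x (eval C (λ _ → x))

module Submission where

-- A unary set-function F is piecewise continuous when 2^ℕ splits into finitely
-- many pieces on each of which F coincides with a continuous function.  Every
-- 𝒰-function, the constants and the Boolean connectives are continuous, so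
-- applying them to piecewise continuous arguments stays piecewise continuous,
-- and a 𝒫-function takes only the two values ∅ and {0}, hence is piecewise
-- constant.  By induction on circuits, every unary (𝒰,𝒫)-definable function is
-- piecewise continuous.
--
-- Sum and Prod are not.  On a finite set y their value is a singleton {v}, and
-- adding a new element above max y strictly increases v.  The piece of a finite
-- set x₀ is continuous at x₀, so every finite set agreeing with x₀ on a long
-- enough initial segment and having a further element lies in another piece.
-- Restricting to such sets discards one piece; iterating, finitely many pieces
-- cannot cover all sets.

open import Defs
open import Data.Bool using (Bool; true; false; _∧_; _∨_; not; if_then_else_; T)
open import Data.Bool.Properties using (∨-identityʳ; ∨-zeroʳ)
open import Data.Empty using (⊥; ⊥-elim)
open import Data.Fin using (Fin; zero; suc; punchIn; punchOut; combine; remQuot)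
open import Data.Fin.Properties using (punchIn-punchOut; remQuot-combine)
open import Data.Nat using (ℕ; zero; suc; _+_; _*_; _≤_; _<_; z≤n; s≤s; _≤?_; >-nonZero)
open import Data.Nat.Properties
open import Data.Product using (_×_; ∃; _,_; proj₁; proj₂)
open import Data.Sum using (inj₁; inj₂)
open import Data.Unit using (tt)
open import Data.Vec.Functional using (_∷_)
open import Function using (_∘_; id; const)
open import Relation.Nullary using (¬_; yes; no)
open import Relation.Binary.PropositionalEquality

∈-singleton : ∀ m → ⟦ m ⟧ m ≡ true
∈-singleton zero = refl
∈-singleton (suc m) = ∈-singleton m

singleton-member : ∀ {n m} → ⟦ m ⟧ n ≡ true → n ≡ m
singleton-member {n} {m} n∈ = ≡ᵇ⇒≡ n m (subst T (sym n∈) tt)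

∉-singleton : ∀ {n m} → n ≢ m → ⟦ m ⟧ n ≡ false
∉-singleton {n} {m} n≢m with ⟦ m ⟧ n in n∈
... | false = refl
... | true = ⊥-elim (n≢m (singleton-member n∈))

agree-weaken : ∀ {m n s t} → m ≤ n → AgreeUpTo n s t → AgreeUpTo m s t
agree-weaken m≤n agr i i≤m = agr i (≤-trans i≤m m≤n)

bounded-member : ∀ {x M N} → BoundedBy x M → x N ≡ true → N < M
bounded-member {x} {M} {N} bd N∈x with M ≤? N
... | yes M≤N with () ← trans (sym N∈x) (bd N M≤N)
... | no M≰N = ≰⇒> M≰N

Separating : (NSet → ℕ → ℕ) → Set
Separating val = ∀ {y b My x N M} → 1 ≤ b → y 0 ≡ false → BoundedBy y My → My ≤ suc b →
  AgreeUpTo b x y → b < N → x N ≡ true → BoundedBy x M → val y My < val x M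

-- Sum and Prod accumulate, with an operation ⊕ of right identity ε, the
-- elements of x below a bound m; val x m is that accumulation.
module Accumulation (val : NSet → ℕ → ℕ) (_⊕_ : ℕ → ℕ → ℕ) (ε : ℕ)
  (⊕-identityʳ : ∀ a → a ⊕ ε ≡ a)
  (val-zero : ∀ x → val x 0 ≡ ε)
  (val-suc : ∀ x m → val x (suc m) ≡ val x m ⊕ (if x m then m else ε)) where

  val-agree : ∀ {x y b} → AgreeUpTo b x y → ∀ m → m ≤ suc b → val x m ≡ val y m
  val-agree {x} {y} agr zero _ = trans (val-zero x) (sym (val-zero y))
  val-agree {x} {y} agr (suc m) m<b+1 = begin
    val x (suc m)                      ≡⟨ val-suc x m ⟩
    val x m ⊕ (if x m then m else ε)   ≡⟨ cong₂ (λ a c → a ⊕ (if c then m else ε))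
                                             (val-agree agr m (≤-trans (n≤1+n m) m<b+1))
                                             (agr m (≤-pred m<b+1)) ⟩
    val y m ⊕ (if y m then m else ε)   ≡⟨ sym (val-suc y m) ⟩
    val y (suc m)                      ∎
    where open ≡-Reasoning

  val-stable : ∀ {x m m'} → BoundedBy x m → m ≤ m' → val x m' ≡ val x m
  val-stable {x} {m} {m'} bd m≤m' with m≤n⇒m<n∨m≡n m≤m'
  ... | inj₂ refl = refl
  val-stable {x} {m} {suc m'} bd _ | inj₁ (s≤s m≤m') = begin
    val x (suc m')                       ≡⟨ val-suc x m' ⟩
    val x m' ⊕ (if x m' then m' else ε)  ≡⟨ cong (λ c → val x m' ⊕ (if c then m' else ε))
                                                (bd m' m≤m') ⟩
    val x m' ⊕ ε                         ≡⟨ ⊕-identityʳ (val x m') ⟩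
    val x m'                             ≡⟨ val-stable bd m≤m' ⟩
    val x m                              ∎
    where open ≡-Reasoning

  Inflationary : NSet → Set
  Inflationary x = ∀ a n → x n ≡ true → a ≤ a ⊕ n

  val-mono : ∀ {x} → Inflationary x → ∀ {m m'} → m ≤ m' → val x m ≤ val x m'
  val-mono {x} infl {m} {m'} m≤m' with m≤n⇒m<n∨m≡n m≤m'
  ... | inj₂ refl = ≤-refl
  val-mono {x} infl {m} {suc m'} _ | inj₁ (s≤s m≤m') =
    ≤-trans (val-mono infl m≤m') (subst (val x m' ≤_) (sym (val-suc x m')) (grow (x m') refl))
    where
    grow : ∀ c → x m' ≡ c → val x m' ≤ val x m' ⊕ (if c then m' else ε)
    grow true m'∈x = infl (val x m') m' m'∈x
    grow false _ = ≤-reflexive (sym (⊕-identityʳ (val x m')))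

  val-grows : ∀ {y b My x N M} → Inflationary x → val x N < val x N ⊕ N →
    BoundedBy y My → My ≤ suc b → AgreeUpTo b x y → b < N → x N ≡ true → BoundedBy x M →
    val y My < val x M
  val-grows {y} {b} {My} {x} {N} {M} infl jump bdy My≤b+1 agr b<N N∈x bdx = begin-strict
    val y My         ≡⟨ sym (val-stable bdy My≤b+1) ⟩
    val y (suc b)    ≡⟨ sym (val-agree agr (suc b) ≤-refl) ⟩
    val x (suc b)    ≤⟨ val-mono infl b<N ⟩
    val x N          <⟨ jump ⟩
    val x N ⊕ N      ≡⟨ cong (λ c → val x N ⊕ (if c then N else ε)) (sym N∈x) ⟩
    val x N ⊕ (if x N then N else ε) ≡⟨ sym (val-suc x N) ⟩
    val x (suc N)    ≤⟨ val-mono infl (bounded-member bdx N∈x) ⟩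
    val x M          ∎
    where open ≤-Reasoning

module SumAccumulation = Accumulation sumBelow _+_ 0 +-identityʳ (λ _ → refl) (λ _ _ → refl)
module ProdAccumulation = Accumulation prodBelow _*_ 1 *-identityʳ (λ _ → refl) (λ _ _ → refl)

sum-separating : Separating sumBelow
sum-separating {x = x} {N = N} _ _ bdy My≤b+1 agr b<N N∈x bdx =
  SumAccumulation.val-grows (λ a n _ → m≤m+n a n) (m<m+n (sumBelow x N) (≤-<-trans z≤n b<N))
    bdy My≤b+1 agr b<N N∈x bdx

-- Since 0 ∉ x, a product over x is positive and every new element N > b ≥ 1
-- increases it.
prod-separating : Separating prodBelow
prod-separating {y} {b} {My} {x} {N} 1≤b 0∉y bdy My≤b+1 agr b<N N∈x bdx =
  ProdAccumulation.val-grows inflationary jump bdy My≤b+1 agr b<N N∈x bdx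
  where
  0∉x : x 0 ≡ false
  0∉x = trans (agr 0 z≤n) 0∉y
  inflationary : ProdAccumulation.Inflationary x
  inflationary a zero 0∈x with () ← trans (sym 0∈x) 0∉x
  inflationary a (suc n) _ = m≤m*n a (suc n)
  positive : 0 < prodBelow x N
  positive = ProdAccumulation.val-mono inflationary {0} {N} z≤n
  jump : prodBelow x N < prodBelow x N * N
  jump = m<m*n (prodBelow x N) N {{>-nonZero positive}} (≤-<-trans 1≤b b<N)

Continuous : ∀ {k} → (NSet → Fin k → NSet) → Set
Continuous g = ∀ x m → ∃ λ n → ∀ y → AgreeUpTo n y x → AgreeUpToVec m (g y) (g x)

constant-continuous : ∀ {k} (c : Fin k → NSet) → Continuous (λ _ → c)
constant-continuous c x m = 0 , λ _ _ _ _ _ → refl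

identity-continuous : Continuous {1} (λ x _ → x)
identity-continuous x m = m , λ y agr _ → agr

∷-continuous : ∀ {k} {g : NSet → Fin 1 → NSet} {gs : NSet → Fin k → NSet} →
  Continuous g → Continuous gs → Continuous (λ x → g x zero ∷ gs x)
∷-continuous {g = g} {gs} g-cont gs-cont x m with g-cont x m | gs-cont x m
... | n₁ , agree₁ | n₂ , agree₂ = n₁ + n₂ , agree
  where
  agree : ∀ y → AgreeUpTo (n₁ + n₂) y x → AgreeUpToVec m (g y zero ∷ gs y) (g x zero ∷ gs x)
  agree y agr zero = agree₁ y (agree-weaken (m≤m+n n₁ n₂) agr) zero
  agree y agr (suc t) = agree₂ y (agree-weaken (m≤n+m n₂ n₁) agr) t

∘-continuous : ∀ {k} {G : SetFun k} {g : NSet → Fin k → NSet} →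
  InU G → Continuous g → Continuous {1} (λ x _ → G (g x))
∘-continuous {G = G} {g} G-cont g-cont x m with G-cont (g x) m
... | n' , agree-G with g-cont x n'
... | n , agree-g = n , λ y agr _ → agree-G (g y) (agree-g y agr)

∈U-respects-≈ : ∀ {k} {G : SetFun k} → InU G → ∀ ss ts → (∀ t → ss t ≈ ts t) → G ss ≈ G ts
∈U-respects-≈ G-cont ss ts ss≈ts n = proj₂ (G-cont ts n) ss (λ t i _ → ss≈ts t i) n ≤-refl

constant : NSet → SetFun 0
constant c _ = c

constant-∈U : ∀ c → InU (constant c)
constant-∈U c _ _ = 0 , λ _ _ _ _ → refl

pointwise₂ : (Bool → Bool → Bool) → SetFun 2
pointwise₂ _⊙_ ss n = ss zero n ⊙ ss (suc zero) n

pointwise₂-∈U : ∀ _⊙_ → InU (pointwise₂ _⊙_)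
pointwise₂-∈U _⊙_ ss m = m , λ ts agr i i≤m → cong₂ _⊙_ (agr zero i i≤m) (agr (suc zero) i i≤m)

complement : SetFun 1
complement ss n = not (ss zero n)

complement-∈U : InU complement
complement-∈U ss m = m , λ ts agr i i≤m → cong not (agr zero i i≤m)

record Piecewise (k : ℕ) (F : NSet → Fin k → NSet) : Set where
  field
    pieces : ℕ
    piece : NSet → Fin pieces
    branch : Fin pieces → NSet → Fin k → NSet
    continuous : ∀ i → Continuous (branch i)
    agrees : ∀ x t → F x t ≈ branch (piece x) x t

identity-piecewise : Piecewise 1 (λ x _ → x)
identity-piecewise = record
  { pieces = 1 ; piece = λ _ → zero ; branch = λ _ x _ → x
  ; continuous = λ _ → identity-continuous ; agrees = λ _ _ _ → refl }

∷-piecewise : ∀ {k} {F : NSet → Fin (suc k) → NSet} →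
  Piecewise 1 (λ x _ → F x zero) → Piecewise k (λ x t → F x (suc t)) → Piecewise (suc k) F
∷-piecewise {k} {F} P Q = record
  { pieces = P.pieces * Q.pieces
  ; piece = λ x → combine (P.piece x) (Q.piece x)
  ; branch = branch ∘ split
  ; continuous = λ i → ∷-continuous (P.continuous (proj₁ (split i)))
                                    (Q.continuous (proj₂ (split i)))
  ; agrees = λ x t n → trans (agrees x t n)
      (cong (λ p → branch p x t n) (sym (remQuot-combine (P.piece x) (Q.piece x)))) }
  where
  module P = Piecewise P
  module Q = Piecewise Q
  split : Fin (P.pieces * Q.pieces) → Fin P.pieces × Fin Q.pieces
  split = remQuot {P.pieces} Q.pieces
  branch : Fin P.pieces × Fin Q.pieces → NSet → Fin (suc k) → NSet
  branch (i , j) x = P.branch i x zero ∷ Q.branch j x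
  agrees : ∀ x t → F x t ≈ branch (P.piece x , Q.piece x) x t
  agrees x zero = P.agrees x zero
  agrees x (suc t) = Q.agrees x t

tuple-piecewise : ∀ k {F : Fin k → NSet → NSet} →
  (∀ t → Piecewise 1 (λ x _ → F t x)) → Piecewise k (λ x t → F t x)
tuple-piecewise zero _ = record
  { pieces = 1 ; piece = λ _ → zero ; branch = λ _ _ ()
  ; continuous = λ _ _ _ → 0 , λ _ _ () ; agrees = λ _ () }
tuple-piecewise (suc k) Ps = ∷-piecewise (Ps zero) (tuple-piecewise k (Ps ∘ suc))

∈U-piecewise : ∀ {k} {G : SetFun k} {F : NSet → Fin k → NSet} →
  InU G → Piecewise k F → Piecewise 1 (λ x _ → G (F x))
∈U-piecewise {G = G} {F} G-cont P = record
  { pieces = pieces ; piece = piece ; branch = λ i x _ → G (branch i x)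
  ; continuous = λ i → ∘-continuous G-cont (continuous i)
  ; agrees = λ x _ → ∈U-respects-≈ G-cont (F x) (branch (piece x) x) (agrees x) }
  where open Piecewise P

∈P-piecewise : ∀ {k} {G : SetFun k} → InP G → (F : NSet → Fin k → NSet) →
  Piecewise 1 (λ x _ → G (F x))
∈P-piecewise {G = G} G-two-valued F = record
  { pieces = 2 ; piece = λ x → select (G (F x) 0) ; branch = λ i _ _ → value i
  ; continuous = λ i → constant-continuous (λ _ → value i) ; agrees = agrees }
  where
  select : Bool → Fin 2
  select false = zero
  select true = suc zero
  value : Fin 2 → NSet
  value zero = ∅
  value (suc _) = ⟦ 0 ⟧
  agrees : ∀ x t → G (F x) ≈ value (select (G (F x) 0))
  agrees x _ n with G-two-valued (F x)
  ... | inj₁ G≈∅ = trans (G≈∅ n) (cong (λ c → value (select c) n) (sym (G≈∅ 0)))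
  ... | inj₂ G≈⟦0⟧ = trans (G≈⟦0⟧ n) (cong (λ c → value (select c) n) (sym (G≈⟦0⟧ 0)))

piecewise : (C : Circuit 1) → Piecewise 1 (λ x _ → eval C (λ _ → x))
piecewise (var _) = identity-piecewise
piecewise empty = ∈U-piecewise (constant-∈U ∅) (tuple-piecewise 0 {λ ()} (λ ()))
piecewise nat = ∈U-piecewise (constant-∈U full) (tuple-piecewise 0 {λ ()} (λ ()))
piecewise (sing m) = ∈U-piecewise (constant-∈U ⟦ m ⟧) (tuple-piecewise 0 {λ ()} (λ ()))
piecewise (union c d) = ∈U-piecewise (pointwise₂-∈U _∨_)
  (tuple-piecewise 2 {λ { zero → eval c ∘ const ; (suc _) → eval d ∘ const }}
    λ { zero → piecewise c ; (suc _) → piecewise d })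
piecewise (inter c d) = ∈U-piecewise (pointwise₂-∈U _∧_)
  (tuple-piecewise 2 {λ { zero → eval c ∘ const ; (suc _) → eval d ∘ const }}
    λ { zero → piecewise c ; (suc _) → piecewise d })
piecewise (compl c) = ∈U-piecewise complement-∈U (tuple-piecewise 1 λ _ → piecewise c)
piecewise (op k G (inj₁ G-cont) cs) = ∈U-piecewise G-cont (tuple-piecewise k λ t → piecewise (cs t))
piecewise (op k G (inj₂ G-two-valued) cs) = ∈P-piecewise G-two-valued (λ x t → eval (cs t) (λ _ → x))

Seed : NSet → ℕ → Set
Seed s b = 1 ≤ b × BoundedBy s (suc b) × s 0 ≡ false

ExtendsBeyond : NSet → ℕ → NSet → Set
ExtendsBeyond s b x = AgreeUpTo b x s × Finite x × ∃ λ N → b < N × x N ≡ true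

addAbove : NSet → ℕ → NSet
addAbove s b n = s n ∨ ⟦ suc b ⟧ n

addAbove-agrees : ∀ s b → AgreeUpTo b (addAbove s b) s
addAbove-agrees s b i i≤b =
  trans (cong (s i ∨_) (∉-singleton (λ i≡b+1 → <-irrefl i≡b+1 (s≤s i≤b)))) (∨-identityʳ (s i))

addAbove-bounded : ∀ {s b} → BoundedBy s (suc b) → BoundedBy (addAbove s b) (suc (suc b))
addAbove-bounded {s} {b} bd n b+1<n =
  trans (cong (_∨ ⟦ suc b ⟧ n) (bd n (≤-trans (n≤1+n (suc b)) b+1<n)))
        (∉-singleton (λ n≡b+1 → <-irrefl (sym n≡b+1) b+1<n))

addAbove-top : ∀ s b → addAbove s b (suc b) ≡ true
addAbove-top s b = trans (cong (s (suc b) ∨_) (∈-singleton (suc b))) (∨-zeroʳ (s (suc b)))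

addAbove-extends : ∀ {s b} → Seed s b → ExtendsBeyond s b (addAbove s b)
addAbove-extends {s} {b} (_ , bd , _) =
  addAbove-agrees s b , (suc (suc b) , addAbove-bounded bd) , suc b , ≤-refl , addAbove-top s b

addAbove-seed : ∀ {s b} → Seed s b → ∀ n → Seed (addAbove s b) (suc b + n)
addAbove-seed {s} {b} (_ , bd , 0∉s) n =
  s≤s z≤n ,
  (λ i le → addAbove-bounded bd i (≤-trans (s≤s (s≤s (m≤m+n b n))) le)) ,
  cong (_∨ false) 0∉s

extends-narrow : ∀ {s t b b' x} → AgreeUpTo b t s → b ≤ b' →
  ExtendsBeyond t b' x → ExtendsBeyond s b x
extends-narrow t≈s b≤b' (agr , finite , N , b'<N , N∈x) =
  (λ i i≤b → trans (agr i (≤-trans i≤b b≤b')) (t≈s i i≤b)) , finite , N , ≤-<-trans b≤b' b'<N , N∈x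

module Exhaustion {F : NSet → NSet} (P : Piecewise 1 (λ x _ → F x))
  {val : NSet → ℕ → ℕ} (separating : Separating val)
  (F-finite : ∀ x M → BoundedBy x M → F x ≈ ⟦ val x M ⟧) where

  open Piecewise P

  -- For a seed s, b let x₀ = s ∪ {b + 1}, so F x₀ = {c}.  The branch of x₀'s piece
  -- is continuous at x₀; beyond the resulting modulus b₀ every extension x of x₀
  -- has F x = {v} with v > c, so it lies in another piece.
  module Separation {s b} (seed : Seed s b) where
    x₀ : NSet
    x₀ = addAbove s b
    c : ℕ
    c = val x₀ (suc (suc b))
    modulus : ℕ
    modulus = proj₁ (continuous (piece x₀) x₀ c)
    b₀ : ℕ
    b₀ = suc b + modulus

    other-piece : ∀ x → ExtendsBeyond x₀ b₀ x → piece x ≢ piece x₀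
    other-piece x (agr , (M , bdx) , N , b₀<N , N∈x) same = <-irrefl c≡v c<v
      where
      x₀-bounded : BoundedBy x₀ (suc (suc b))
      x₀-bounded = addAbove-bounded (proj₁ (proj₂ seed))
      c∈Fx : F x c ≡ true
      c∈Fx = begin
        F x c                       ≡⟨ agrees x zero c ⟩
        branch (piece x) x zero c   ≡⟨ cong (λ i → branch i x zero c) same ⟩
        branch (piece x₀) x zero c  ≡⟨ proj₂ (continuous (piece x₀) x₀ c) x
                                          (agree-weaken (m≤n+m modulus (suc b)) agr) zero c ≤-refl ⟩
        branch (piece x₀) x₀ zero c ≡⟨ sym (agrees x₀ zero c) ⟩
        F x₀ c                      ≡⟨ F-finite x₀ (suc (suc b)) x₀-bounded c ⟩
        ⟦ c ⟧ c                     ≡⟨ ∈-singleton c ⟩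
        true                        ∎
        where open ≡-Reasoning
      c≡v : c ≡ val x M
      c≡v = singleton-member (trans (sym (F-finite x M bdx c)) c∈Fx)
      c<v : c < val x M
      c<v = let (1≤b₀ , _ , 0∉x₀) = addAbove-seed seed modulus in
        separating 1≤b₀ 0∉x₀ x₀-bounded (s≤s (s≤s (m≤m+n b modulus))) agr b₀<N N∈x bdx

  -- No K pieces cover all extensions of a seed: the piece of x₀ can be dropped.
  exhaust : ∀ K {s b} → Seed s b → (e : Fin K → Fin pieces) →
    (∀ x → ExtendsBeyond s b x → ∃ λ k → e k ≡ piece x) → ⊥
  exhaust zero seed e cover with () ← proj₁ (cover _ (addAbove-extends seed))
  exhaust (suc K) {s} {b} seed e cover with cover _ (addAbove-extends seed)
  ... | k₀ , ek₀≡ = exhaust K (addAbove-seed seed modulus) (e ∘ punchIn k₀) cover'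
    where
    open Separation seed
    b≤b₀ : b ≤ b₀
    b≤b₀ = ≤-trans (n≤1+n b) (m≤m+n (suc b) modulus)
    cover' : ∀ x → ExtendsBeyond x₀ b₀ x → ∃ λ k → e (punchIn k₀ k) ≡ piece x
    cover' x ext with cover x (extends-narrow (addAbove-agrees s b) b≤b₀ ext)
    ... | k , ek≡ = punchOut k₀≢k , trans (cong e (punchIn-punchOut k₀≢k)) ek≡
      where
      k₀≢k : k₀ ≢ k
      k₀≢k k₀≡k = other-piece x ext (trans (sym ek≡) (trans (cong e (sym k₀≡k)) ek₀≡))

  impossible : ⊥
  impossible = exhaust pieces {∅} {1} (≤-refl , (λ _ _ → refl) , refl) id (λ x _ → piece x , refl)

not-definable : ∀ {R val} → Separating val →
  (∀ x y → R x y → ∀ M → BoundedBy x M → y ≈ ⟦ val x M ⟧) → ¬ UPDefinable₁ R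
not-definable separating R-finite (C , C-computes-R) =
  Exhaustion.impossible (piecewise C) separating (λ x M bdx → R-finite x _ (C-computes-R x) M bdx)

corollary2 : ¬ UPDefinable₁ IsSum × ¬ UPDefinable₁ IsProd
corollary2 = not-definable {IsSum} sum-separating (λ _ _ → proj₁)
           , not-definable {IsProd} prod-separating (λ _ _ → proj₁)
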